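{- For every finite graph $G$ and every integer $t\geq 1$, we have $\operatorname{col}_t(G)\leq (2t+1)(\operatorname{rtw}(G)+1)$.
   Context: For a linear order $\pi$ of $V(G)$, a vertex $u$ is $t$-accessible from $v$ if $u\leq v$ in $\pi$ and there is a $u$–$v$ path of length at most $t$ all of whose inner vertices $w$ satisfy $v<w$ in $\pi$; $\mathrm{Reach}_t(v,\pi)$ is the set of vertices $t$-accessible from $v$ (including $v$), and $\operatorname{col}_t(G)=\min_\pi\max_{v\in V(G)}|\mathrm{Reach}_t(v,\pi)|$. A $k$-tree is defined recursively: $K_{k+1}$ is a $k$-tree, and adding a new vertex adjacent to all vertices of a $k$-clique of a $k$-tree yields a $k$-tree. The strong product $H\boxtimes H'$ has vertex set $V(H)\times V(H')$, with $(u,x)$ adjacent to $(v,y)$ iff ($u=v$ and $xy\in E(H')$) or ($x=y$ and $uv\in E(H)$) or ($uv\in E(H)$ and $xy\in E(H')$). The row-treewidth $\operatorname{rtw}(G)$ is the minimum $k$ such that $G$ is a subgraph of $H\boxtimes P$ for some $k$-tree $H$ and some path $P$. -}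

module Defs where

open import Level using (0ℓ)
open import Data.Nat using (ℕ; zero; suc; _≤_; _<_)
open import Data.Fin using (Fin; zero; suc; toℕ)
open import Data.List using (List; []; _∷_; _++_; [_]; length)
open import Data.List.Relation.Unary.All using (All)
open import Data.List.Relation.Unary.Linked using (Linked)
open import Data.List.Relation.Unary.Unique.Propositional using (Unique)
open import Data.List.Membership.Propositional using (_∈_)
open import Data.Product using (Σ; _×_; ∃; ∃-syntax; _,_)
open import Data.Sum using (_⊎_)
open import Data.Empty using (⊥)
open import Relation.Binary.PropositionalEquality using (_≡_; _≢_)
open import Function.Definitions using (Injective)

record Graph : Set₁ where
  field
    n      : ℕ
    Adj    : Fin n → Fin n → Set
    sym    : ∀ {u v} → Adj u v → Adj v u
    irrefl : ∀ {u} → Adj u u → ⊥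

open Graph public

-- A linear order of V(G), given as an injective "position" map
-- (injective Fin n → Fin n, hence a bijection): u ≤_π v iff pos u ≤ pos v.
LinearOrder : ℕ → Set
LinearOrder n = Σ (Fin n → Fin n) (λ pos → Injective _≡_ _≡_ pos)

module _ (G : Graph) where
  private
    V = Fin (n G)
    E = Adj G

  InReach : ℕ → LinearOrder (n G) → V → V → Set
  InReach t (pos , _) v u =
    u ≡ v ⊎
    (toℕ (pos u) ≤ toℕ (pos v) ×
     ∃[ ws ] (Linked E (u ∷ ws ++ [ v ]) ×
              Unique (u ∷ ws ++ [ v ]) ×
              suc (length ws) ≤ t ×
              All (λ w → toℕ (pos v) < toℕ (pos w)) ws))

  -- |Reach_t(v, π)| ≤ c : the set is covered by a list of at most c vertices.
  ReachSizeAtMost : ℕ → LinearOrder (n G) → V → ℕ → Set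
  ReachSizeAtMost t π v c =
    ∃[ L ] (length L ≤ c × (∀ u → InReach t π v u → u ∈ L))

  -- col_t(G) ≤ c  (col_t is a minimum over linear orders of a maximum over vertices)
  ColAtMost : ℕ → ℕ → Set
  ColAtMost t c = ∃[ π ] (∀ v → ReachSizeAtMost t π v c)

-- k-trees, built on vertex sets Fin m. The new vertex in a step is `zero`,
-- old vertices are shifted by `suc`.
extend : ∀ {m} → (Fin m → Fin m → Set) → List (Fin m) → Fin (suc m) → Fin (suc m) → Set
extend A C zero    zero    = ⊥
extend A C zero    (suc j) = j ∈ C
extend A C (suc i) zero    = i ∈ C
extend A C (suc i) (suc j) = A i j

data KTree (k : ℕ) : (m : ℕ) → (Fin m → Fin m → Set) → Set₁ where
  base : KTree k (suc k) (λ x y → x ≢ y)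
  add  : ∀ {m A} → KTree k m A → (C : List (Fin m)) →
         length C ≡ k → Unique C →
         (∀ x y → x ∈ C → y ∈ C → x ≢ y → A x y) →
         KTree k (suc m) (extend A C)

PathAdj : ∀ {ℓ} → Fin ℓ → Fin ℓ → Set
PathAdj i j = toℕ j ≡ suc (toℕ i) ⊎ toℕ i ≡ suc (toℕ j)

StrongAdj : ∀ {a b} → (Fin a → Fin a → Set) → (Fin b → Fin b → Set) →
            Fin a × Fin b → Fin a × Fin b → Set
StrongAdj A B (u , x) (v , y) =
  (u ≡ v × B x y) ⊎ (x ≡ y × A u v) ⊎ (A u v × B x y)

-- G is a subgraph of H ⊠ P for some k-tree H and some path P
-- (subgraph up to isomorphism = injective edge-preserving map).
RowDecomposition : Graph → ℕ → Set₁
RowDecomposition G k =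
  ∃[ m ] Σ (Fin m → Fin m → Set) λ A → KTree k m A ×
  ∃[ ℓ ] Σ (Fin (n G) → Fin m × Fin ℓ) λ f →
    Injective _≡_ _≡_ f ×
    (∀ u v → Adj G u v → StrongAdj A (PathAdj {ℓ}) (f u) (f v))

-- Order V(G) by the column a vertex occupies in H ⊠ P, the oldest vertex of the
-- k-tree construction of H first (ties broken arbitrarily). If u is weakly
-- t-reachable from v, the path projects to a walk in H from column(u) to column(v)
-- through columns no older than column(v); in a k-tree such a walk can only start
-- at column(v) or in the k-clique that column(v) was attached to. The path also
-- moves at most t rows, so u lies in one of (k + 1)(2t + 1) cells of H ⊠ P, and
-- each cell holds at most one vertex of G.

module Submission where

open import Defs hiding (sym)
open import Level using (0ℓ)
open import Data.Nat using (ℕ; zero; suc; _≤_; _<_; _+_; _*_; _∸_; ∣_-_∣; z≤n; s≤s; s≤s⁻¹; z<s; _<?_)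
open import Data.Nat.Properties
open import Data.Fin as Fin using (Fin; zero; suc; toℕ; fromℕ<; punchIn; punchOut; combine)
open import Data.Fin.Properties
  using (toℕ-injective; toℕ-fromℕ<; punchIn-punchOut; any?; combine-injective; combine-monoˡ-<)
open import Data.Fin.Subset using (Subset; _⊂_; ⊤; ∣_∣) renaming (_∈_ to _∈ₛ_)
open import Data.Fin.Subset.Properties using (∈⊤; ∣⊤∣≡n; p⊂q⇒∣p∣<∣q∣)
open import Data.Vec as Vec using ()
open import Data.Vec.Properties using (lookup∘tabulate; lookup⇒[]=; []=⇒lookup)
open import Data.List using (List; []; _∷_; _++_; [_]; length; map; allFin; applyUpTo; cartesianProduct; mapMaybe)
open import Data.List.Properties using (length-map; length-++; length-tabulate; length-applyUpTo; length-mapMaybe)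
open import Data.List.Relation.Unary.All using (All; []; _∷_)
open import Data.List.Relation.Unary.Any using (here; there)
open import Data.List.Relation.Unary.Linked using (Linked; [-]; _∷_)
open import Data.List.Membership.Propositional using (_∈_)
open import Data.List.Membership.Propositional.Properties
  using (∈-map⁺; ∈-allFin; ∈-applyUpTo⁺; ∈-cartesianProduct⁺)
open import Data.Maybe using (Maybe; just; nothing)
open import Data.Product using (_×_; _,_; proj₁; proj₂)
open import Data.Product.Properties using (≡-dec)
open import Data.Sum using (inj₁; inj₂)
open import Relation.Nullary using (yes; no; contradiction; does; proof)
open import Relation.Nullary.Decidable using (dec-true)
open import Relation.Nullary.Reflects using (Reflects; invert)
open import Relation.Unary using (Pred; Decidable)
open import Relation.Binary using (Rel; DecidableEquality; tri<; tri≈; tri>)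
open import Relation.Binary.Construct.Closure.Reflexive using (ReflClosure) renaming (refl to stay; [_] to move)
open import Relation.Binary.PropositionalEquality
  using (_≡_; _≢_; refl; sym; trans; cong; cong₂; subst; subst₂; module ≡-Reasoning)
open import Function using (_∘_; id)
open import Function.Definitions using (Injective)

data Walk {X : Set} (R : Rel X 0ℓ) (P : Pred X 0ℓ) : Rel X 0ℓ where
  edge : ∀ {x y} → R x y → Walk R P x y
  via  : ∀ {x y z} → R x y → P y → Walk R P y z → Walk R P x z

walk-map : ∀ {X Y : Set} {R : Rel X 0ℓ} {P : Pred X 0ℓ} {S : Rel Y 0ℓ} {Q : Pred Y 0ℓ}
           (g : X → Y) → (∀ {x y} → R x y → S (g x) (g y)) → (∀ {x} → P x → Q (g x)) →
           ∀ {x y} → Walk R P x y → Walk S Q (g x) (g y)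
walk-map g R⇒S P⇒Q (edge r)    = edge (R⇒S r)
walk-map g R⇒S P⇒Q (via r p w) = via (R⇒S r) (P⇒Q p) (walk-map g R⇒S P⇒Q w)

linked⇒walk : ∀ {X : Set} {R : Rel X 0ℓ} {P : Pred X 0ℓ} u ws v →
              Linked R (u ∷ ws ++ [ v ]) → All P ws → Walk R P u v
linked⇒walk u []       v (r ∷ [-]) []       = edge r
linked⇒walk u (w ∷ ws) v (r ∷ rs)  (p ∷ ps) = via r p (linked⇒walk w ws v rs ps)

linked-∣-∣≤ : ∀ {X : Set} {R : Rel X 0ℓ} (φ : X → ℕ) → (∀ {x y} → R x y → ∣ φ x - φ y ∣ ≤ 1) →
              ∀ u ws v → Linked R (u ∷ ws ++ [ v ]) → ∣ φ u - φ v ∣ ≤ suc (length ws)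
linked-∣-∣≤ φ φ-step u []       v (r ∷ [-]) = φ-step r
linked-∣-∣≤ φ φ-step u (w ∷ ws) v (r ∷ rs)  =
  ≤-trans (∣-∣-triangle (φ u) (φ w) (φ v)) (+-mono-≤ (φ-step r) (linked-∣-∣≤ φ φ-step w ws v rs))

parentClique : ∀ {k m A} → KTree k m A → Fin m → List (Fin m)
parentClique {k} base          a       = map (punchIn a) (allFin k)
parentClique (add T C _ _ _)   zero    = map suc C
parentClique (add T C _ _ _)   (suc a) = map suc (parentClique T a)

length-parentClique : ∀ {k m A} (T : KTree k m A) a → length (parentClique T a) ≡ k
length-parentClique {k} base a = trans (length-map (punchIn a) (allFin k)) (length-tabulate id)
length-parentClique (add T C |C|≡k _ _) zero    = trans (length-map suc C) |C|≡k
length-parentClique (add T C _ _ _)     (suc a) =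
  trans (length-map suc (parentClique T a)) (length-parentClique T a)

module _ {m} {A : Rel (Fin m) 0ℓ} {C : List (Fin m)}
         (C-clique : ∀ x y → x ∈ C → y ∈ C → x ≢ y → A x y) {Q : Pred (Fin (suc m)) 0ℓ} where

  private
    Step  = ReflClosure (extend A C)
    Step⁻ = ReflClosure A

  clique-step : ∀ {x y} → x ∈ C → y ∈ C → Step⁻ x y
  clique-step {x} {y} x∈C y∈C with x Fin.≟ y
  ... | yes refl = stay
  ... | no x≢y   = move (C-clique x y x∈C y∈C x≢y)

  old-step : ∀ {x y} → Step (suc x) (suc y) → Step⁻ x y
  old-step stay     = stay
  old-step (move a) = move a

  -- The newest vertex is adjacent exactly to the clique C, so a visit to it can be shortcut.
  mutual
    remove-newest : ∀ {x y} → Walk Step Q (suc x) (suc y) → Walk Step⁻ (Q ∘ suc) x y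
    remove-newest (edge r)                        = edge (old-step r)
    remove-newest (via {y = zero} (move x∈C) _ w) = bypass-newest x∈C w
    remove-newest (via {y = suc _} r q w)         = via (old-step r) q (remove-newest w)

    bypass-newest : ∀ {x y} → x ∈ C → Walk Step Q zero (suc y) → Walk Step⁻ (Q ∘ suc) x y
    bypass-newest x∈C (edge (move y∈C))                = edge (clique-step x∈C y∈C)
    bypass-newest x∈C (via {y = zero} stay _ w)        = bypass-newest x∈C w
    bypass-newest x∈C (via {y = suc _} (move z∈C) q w) = via (clique-step x∈C z∈C) q (remove-newest w)

-- Vertex zero is the newest, so `x Fin.≤ a` means that x was added no earlier than a.
walk⇒∈parentClique : ∀ {k m A} (T : KTree k m A) {a b : Fin m} → a Fin.≤ b →
                     Walk (ReflClosure A) (Fin._≤ a) b a → b ∈ a ∷ parentClique T a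
walk⇒∈parentClique {k} base {a} {b} _ _ with b Fin.≟ a
... | yes b≡a = here b≡a
... | no b≢a  = there (subst (_∈ map (punchIn a) (allFin k)) (punchIn-punchOut (b≢a ∘ sym))
                        (∈-map⁺ (punchIn a) (∈-allFin (punchOut (b≢a ∘ sym)))))
walk⇒∈parentClique (add T C _ _ _) {zero}  {zero}  _ _                            = here refl
walk⇒∈parentClique (add T C _ _ _) {zero}  {suc b} _ (edge (move b∈C))            = there (∈-map⁺ suc b∈C)
walk⇒∈parentClique (add T C _ _ _) {zero}  {suc b} _ (via {y = zero} (move b∈C) _ _) =
  there (∈-map⁺ suc b∈C)
walk⇒∈parentClique (add T C _ _ _) {zero}  {suc b} _ (via {y = suc _} _ () _)
walk⇒∈parentClique (add T C _ _ _) {suc a} {zero}  () _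
walk⇒∈parentClique (add T C _ _ C-clique) {suc a} {suc b} (s≤s a≤b) w
  with walk⇒∈parentClique T a≤b (walk-map id id s≤s⁻¹ (remove-newest C-clique w))
... | here b≡a   = here (cong suc b≡a)
... | there b∈Pa = there (∈-map⁺ suc b∈Pa)

toSubset : ∀ {n} {P : Pred (Fin n) 0ℓ} → Decidable P → Subset n
toSubset P? = Vec.tabulate (does ∘ P?)

module _ {n} {P : Pred (Fin n) 0ℓ} (P? : Decidable P) where

  ∈-toSubset⁺ : ∀ {x} → P x → x ∈ₛ toSubset P?
  ∈-toSubset⁺ {x} px = lookup⇒[]= x _ (trans (lookup∘tabulate _ x) (dec-true (P? x) px))

  ∈-toSubset⁻ : ∀ {x} → x ∈ₛ toSubset P? → P x
  ∈-toSubset⁻ {x} x∈ = invert (subst (Reflects (P x)) does≡true (proof (P? x)))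
    where
    does≡true = trans (sym (lookup∘tabulate _ x)) ([]=⇒lookup x∈)

module _ {n} (key : Fin n → ℕ) (key-injective : Injective _≡_ _≡_ key) where

  keyAbove? : ∀ x → Decidable (λ w → key x < key w)
  keyAbove? x w = key x <? key w

  above : Fin n → Subset n
  above x = toSubset (keyAbove? x)

  above⊂⊤ : ∀ x → above x ⊂ ⊤
  above⊂⊤ x = (λ _ → ∈⊤) , x , ∈⊤ , <-irrefl refl ∘ ∈-toSubset⁻ (keyAbove? x)

  above-⊂ : ∀ {x y} → key x < key y → above y ⊂ above x
  above-⊂ {x} {y} kx<ky =
    (∈-toSubset⁺ (keyAbove? x) ∘ <-trans kx<ky ∘ ∈-toSubset⁻ (keyAbove? y)) ,
    y , ∈-toSubset⁺ (keyAbove? x) kx<ky , <-irrefl refl ∘ ∈-toSubset⁻ (keyAbove? y)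

  rank : Fin n → Fin n
  rank x = fromℕ< (subst (∣ above x ∣ <_) (∣⊤∣≡n n) (p⊂q⇒∣p∣<∣q∣ (above⊂⊤ x)))

  toℕ-rank : ∀ x → toℕ (rank x) ≡ ∣ above x ∣
  toℕ-rank x = toℕ-fromℕ< _

  rank-antitone : ∀ {x y} → key x < key y → rank y Fin.< rank x
  rank-antitone {x} {y} kx<ky =
    subst₂ _<_ (sym (toℕ-rank y)) (sym (toℕ-rank x)) (p⊂q⇒∣p∣<∣q∣ (above-⊂ kx<ky))

  rank-injective : Injective _≡_ _≡_ rank
  rank-injective {x} {y} rx≡ry with <-cmp (key x) (key y)
  ... | tri< kx<ky _ _ = contradiction (sym (cong toℕ rx≡ry)) (<⇒≢ (rank-antitone kx<ky))
  ... | tri≈ _ kx≡ky _ = key-injective kx≡ky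
  ... | tri> _ _ ky<kx = contradiction (cong toℕ rx≡ry) (<⇒≢ (rank-antitone ky<kx))

module _ {n} {B : Set} (_≟_ : DecidableEquality B) (g : Fin n → B) where

  preimage : B → Maybe (Fin n)
  preimage b with any? (λ w → g w ≟ b)
  ... | yes (w , _) = just w
  ... | no _        = nothing

  preimage-injective : Injective _≡_ _≡_ g → ∀ u → preimage (g u) ≡ just u
  preimage-injective g-injective u with any? (λ w → g w ≟ g u)
  ... | yes (w , gw≡gu) = cong just (g-injective gw≡gu)
  ... | no ∄w           = contradiction (u , refl) ∄w

∈-mapMaybe⁺ : ∀ {A B : Set} (f : A → Maybe B) {x y xs} → x ∈ xs → f x ≡ just y → y ∈ mapMaybe f xs
∈-mapMaybe⁺ f (here refl) fx≡y rewrite fx≡y = here refl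
∈-mapMaybe⁺ f {xs = x′ ∷ xs} (there x∈xs) fx≡y with f x′
... | just _  = there (∈-mapMaybe⁺ f x∈xs fx≡y)
... | nothing = ∈-mapMaybe⁺ f x∈xs fx≡y

length-cartesianProduct : ∀ {A B : Set} (xs : List A) (ys : List B) →
                          length (cartesianProduct xs ys) ≡ length xs * length ys
length-cartesianProduct []       ys = refl
length-cartesianProduct (x ∷ xs) ys = begin
  length (map (x ,_) ys ++ cartesianProduct xs ys)           ≡⟨ length-++ (map (x ,_) ys) ⟩
  length (map (x ,_) ys) + length (cartesianProduct xs ys)   ≡⟨ cong₂ _+_ (length-map (x ,_) ys)
                                                                          (length-cartesianProduct xs ys) ⟩
  length ys + length xs * length ys                          ∎
  where open ≡-Reasoning

-- The rows b - t, …, b + t; for b < t truncated subtraction repeats row 0 instead.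
window : ℕ → ℕ → List ℕ
window t b = applyUpTo (λ i → b + i ∸ t) (2 * t + 1)

length-window : ∀ t b → length (window t b) ≡ 2 * t + 1
length-window t b = length-applyUpTo _ (2 * t + 1)

∈-window : ∀ {t b r} → ∣ r - b ∣ ≤ t → r ∈ window t b
∈-window {t} {b} {r} ∣r-b∣≤t = subst (_∈ window t b) b+i∸t≡r (∈-applyUpTo⁺ _ i<2t+1)
  where
  i = r + t ∸ b

  b≤r+t : b ≤ r + t
  b≤r+t = ≤-trans (m≤n+∣m-n∣ b r) (+-monoʳ-≤ r (subst (_≤ t) (∣-∣-comm r b) ∣r-b∣≤t))

  b+i∸t≡r : b + i ∸ t ≡ r
  b+i∸t≡r = trans (cong (_∸ t) (m+[n∸m]≡n b≤r+t)) (m+n∸n≡m r t)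

  i<2t+1 : i < 2 * t + 1
  i<2t+1 = begin-strict
    r + t ∸ b  ≤⟨ m≤n+o⇒m∸n≤o (r + t) b r+t≤b+2t ⟩
    2 * t      <⟨ m<m+n (2 * t) z<s ⟩
    2 * t + 1  ∎
    where
    open ≤-Reasoning
    r+t≤b+2t : r + t ≤ b + 2 * t
    r+t≤b+2t = begin
      r + t            ≤⟨ +-monoˡ-≤ t (≤-trans (m≤n+∣m-n∣ r b) (+-monoʳ-≤ b ∣r-b∣≤t)) ⟩
      b + t + t        ≡⟨ +-assoc b t t ⟩
      b + (t + t)      ≡⟨ cong (λ s → b + (t + s)) (sym (+-identityʳ t)) ⟩
      b + 2 * t        ∎

strongAdj⇒reflClosure : ∀ {a b} {A : Rel (Fin a) 0ℓ} {B : Rel (Fin b) 0ℓ} {u v x y} →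
                        StrongAdj A B (u , x) (v , y) → ReflClosure A u v × ReflClosure B x y
strongAdj⇒reflClosure (inj₁ (refl , x~y))        = stay , move x~y
strongAdj⇒reflClosure (inj₂ (inj₁ (refl , u~v))) = move u~v , stay
strongAdj⇒reflClosure (inj₂ (inj₂ (u~v , x~y)))  = move u~v , move x~y

∣n-1+n∣≡1 : ∀ n → ∣ n - suc n ∣ ≡ 1
∣n-1+n∣≡1 zero    = refl
∣n-1+n∣≡1 (suc n) = ∣n-1+n∣≡1 n

pathStep⇒∣-∣≤1 : ∀ {ℓ} {i j : Fin ℓ} → ReflClosure PathAdj i j → ∣ toℕ i - toℕ j ∣ ≤ 1
pathStep⇒∣-∣≤1 {i = i} stay = subst (_≤ 1) (sym (∣n-n∣≡0 (toℕ i))) z≤n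
pathStep⇒∣-∣≤1 {i = i} {j} (move (inj₁ j≡1+i)) rewrite j≡1+i = ≤-reflexive (∣n-1+n∣≡1 (toℕ i))
pathStep⇒∣-∣≤1 {i = i} {j} (move (inj₂ i≡1+j)) rewrite i≡1+j =
  ≤-reflexive (trans (∣-∣-comm (suc (toℕ j)) (toℕ j)) (∣n-1+n∣≡1 (toℕ j)))

module RowEmbedding (G : Graph) {k m} {A : Rel (Fin m) 0ℓ} (T : KTree k m A) {ℓ}
                    (f : Fin (n G) → Fin m × Fin ℓ) (f-injective : Injective _≡_ _≡_ f)
                    (f-adj : ∀ u v → Adj G u v → StrongAdj A (PathAdj {ℓ}) (f u) (f v))
                    (t : ℕ) where

  column : Fin (n G) → Fin m
  column = proj₁ ∘ f

  row : Fin (n G) → ℕ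
  row = toℕ ∘ proj₂ ∘ f

  strong-step : ∀ {x y} → Adj G x y →
                ReflClosure A (column x) (column y) × ReflClosure PathAdj (proj₂ (f x)) (proj₂ (f y))
  strong-step {x} {y} x~y = strongAdj⇒reflClosure {A = A} {B = PathAdj} (f-adj x y x~y)

  column-step : ∀ {x y} → Adj G x y → ReflClosure A (column x) (column y)
  column-step = proj₁ ∘ strong-step

  row-step : ∀ {x y} → Adj G x y → ∣ row x - row y ∣ ≤ 1
  row-step = pathStep⇒∣-∣≤1 ∘ proj₂ ∘ strong-step

  key : Fin (n G) → ℕ
  key x = toℕ (combine (column x) x)

  key-injective : Injective _≡_ _≡_ key
  key-injective {x} {y} = proj₂ ∘ combine-injective (column x) x (column y) y ∘ toℕ-injective

  pos : Fin (n G) → Fin (n G)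
  pos = rank key key-injective

  π : LinearOrder (n G)
  π = pos , rank-injective key key-injective

  pos-antitone : ∀ {u v} → column u Fin.< column v → pos v Fin.< pos u
  pos-antitone {u} {v} = rank-antitone key key-injective ∘ combine-monoˡ-< u v

  pos≤⇒column≥ : ∀ {u v} → pos u Fin.≤ pos v → column v Fin.≤ column u
  pos≤⇒column≥ pu≤pv = ≮⇒≥ (λ bu<bv → <⇒≱ (pos-antitone bu<bv) pu≤pv)

  pos<⇒column≤ : ∀ {v w} → pos v Fin.< pos w → column w Fin.≤ column v
  pos<⇒column≤ pv<pw = ≮⇒≥ (λ bv<bw → <-asym (pos-antitone bv<bw) pv<pw)

  cell : Fin (n G) → ℕ × Fin m
  cell x = row x , column x

  cell-injective : Injective _≡_ _≡_ cell
  cell-injective cx≡cy = f-injective (cong₂ _,_ (cong proj₂ cx≡cy) (toℕ-injective (cong proj₁ cx≡cy)))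

  cell-≟ : DecidableEquality (ℕ × Fin m)
  cell-≟ = ≡-dec _≟_ Fin._≟_

  cell⁻¹ : ℕ × Fin m → Maybe (Fin (n G))
  cell⁻¹ = preimage cell-≟ cell

  candidates : Fin (n G) → List (Fin (n G))
  candidates v = mapMaybe cell⁻¹ (cartesianProduct (window t (row v)) (column v ∷ parentClique T (column v)))

  length-candidates : ∀ v → length (candidates v) ≤ (2 * t + 1) * (k + 1)
  length-candidates v = begin
    length (candidates v)
      ≤⟨ length-mapMaybe cell⁻¹ grid ⟩
    length grid
      ≡⟨ length-cartesianProduct (window t (row v)) _ ⟩
    length (window t (row v)) * suc (length (parentClique T (column v)))
      ≡⟨ cong₂ (λ a b → a * suc b) (length-window t (row v)) (length-parentClique T (column v)) ⟩
    (2 * t + 1) * suc k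
      ≡⟨ cong ((2 * t + 1) *_) (+-comm 1 k) ⟩
    (2 * t + 1) * (k + 1)
      ∎
    where
    open ≤-Reasoning
    grid = cartesianProduct (window t (row v)) (column v ∷ parentClique T (column v))

  ∈-candidates : ∀ {u v} → column u ∈ column v ∷ parentClique T (column v) → ∣ row u - row v ∣ ≤ t →
                 u ∈ candidates v
  ∈-candidates {u} column∈ ∣Δrow∣≤t =
    ∈-mapMaybe⁺ cell⁻¹ (∈-cartesianProduct⁺ (∈-window ∣Δrow∣≤t) column∈)
                       (preimage-injective cell-≟ cell cell-injective u)

  reach⊆candidates : ∀ v u → InReach G t π v u → u ∈ candidates v
  reach⊆candidates v u (inj₁ refl) =
    ∈-candidates (here refl) (subst (_≤ t) (sym (∣n-n∣≡0 (row v))) z≤n)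
  reach⊆candidates v u (inj₂ (pu≤pv , ws , path , _ , |ws|<t , inner-later)) =
    ∈-candidates (walk⇒∈parentClique T (pos≤⇒column≥ pu≤pv) column-walk)
                 (≤-trans (linked-∣-∣≤ row row-step u ws v path) |ws|<t)
    where
    column-walk = walk-map column column-step pos<⇒column≤ (linked⇒walk u ws v path inner-later)

lemma12 : (G : Graph) (t : ℕ) → 1 ≤ t →
          (k : ℕ) → RowDecomposition G k →
          ColAtMost G t ((2 * t + 1) * (k + 1))
lemma12 G t _ k (m , A , T , ℓ , f , f-injective , f-adj) =
  π , λ v → candidates v , length-candidates v , reach⊆candidates v
  where open RowEmbedding G T f f-injective f-adj t
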